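{- For every integer $n\ge 2$, $$2n\binom{2n}{n}\ \Big|\ \sum_{k=0}^{n-1}(3k+1)\binom{2k}{k}^3 16^{\,n-1-k}.$$
   Context: Divisibility is in the integers. -}

module Defs where

open import Data.Nat using (ℕ; _+_; _*_; _∸_; _^_)
open import Data.Nat.Combinatorics using (_C_)
open import Data.List using (map; upTo)
open import Data.Nat.ListAction using (sum)

S : ℕ → ℕ
S n = sum (map (λ k → (3 * k + 1) * ((2 * k) C k) ^ 3 * 16 ^ (n ∸ 1 ∸ k)) (upTo n))

-- Let c k = C(2k, k) and A m = ∑_{i ≤ m} 4^(m-i) C(2i, i) C(m+i, i).  Then
--   2 S (m+1) = (m+1) c (m+1) A m,
-- because both sides satisfy the same recurrence in m: for S, peel off the last
-- term of the sum; for A,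
--   2 (2m+3) A (m+1) = 16 (m+1) A m + 2 (3m+4) c (m+1)²,
-- which follows from a contiguous relation between C(m+i, i) and C(m+1+i, i).
-- Finally A (m+1) is 4 times an integer plus c (m+1)², and c (m+1) is even, so
-- 4 ∣ A (m+1); halving 2 S n = n c n A (n-1) then gives 2n C(2n, n) ∣ S n.

module Submission where

open import Defs
open import Data.Nat using (ℕ; zero; suc; _+_; _*_; _∸_; _^_; _≤_; s≤s; _!)
open import Data.Nat.Properties using (+-identityʳ; *-identityˡ; *-identityʳ; +-suc; +-comm; *-comm; *-assoc; *-cancelʳ-≡; *-cancelˡ-≡; _!*_!≢0; ∸-+-assoc)
open import Data.Nat.Combinatorics using (_C_; nCn≡1; nCk+nC[k+1]≡[n+1]C[k+1])
open import Data.Nat.Divisibility using (_∣_; m∣m*n; *-pres-∣; ∣m∣n⇒∣m+n; *-cancelˡ-∣; divides)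
open import Data.List using (map; upTo; applyUpTo)
open import Data.List.Properties using (map-upTo; map-applyUpTo; map-cong)
open import Data.Nat.ListAction using (sum)
open import Function using (_∘_)
open import Relation.Binary.PropositionalEquality using (_≡_; refl; sym; trans; cong; cong₂; subst; module ≡-Reasoning)
open import Data.Nat.Tactic.RingSolver using (solve-∀)
open ≡-Reasoning

-- binom a b is (a + b) C b, recomputed by Pascal's rule so that its
-- factorial description can be proved by induction.
binom : ℕ → ℕ → ℕ
binom zero    b       = 1
binom (suc a) zero    = 1
binom (suc a) (suc b) = binom a (suc b) + binom (suc a) b

binom*a!*b!≡[a+b]! : ∀ a b → binom a b * (a ! * b !) ≡ (a + b) !
binom*a!*b!≡[a+b]! zero    b    = trans (*-identityˡ _) (*-identityˡ _)
binom*a!*b!≡[a+b]! (suc a) zero =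
  trans (trans (*-identityˡ _) (*-identityʳ _)) (cong _! (sym (+-identityʳ (suc a))))
binom*a!*b!≡[a+b]! (suc a) (suc b) = begin
  (binom a (suc b) + binom (suc a) b) * (suc a ! * suc b !)
    ≡⟨ distribute (binom a (suc b)) (binom (suc a) b) a b (a !) (b !) ⟩
  binom a (suc b) * (a ! * suc b !) * suc a + binom (suc a) b * (suc a ! * b !) * suc b
    ≡⟨ cong₂ (λ u v → u * suc a + v * suc b) (binom*a!*b!≡[a+b]! a (suc b)) (binom*a!*b!≡[a+b]! (suc a) b) ⟩
  (a + suc b) ! * suc a + (suc a + b) ! * suc b
    ≡⟨ cong (λ w → w ! * suc a + (suc a + b) ! * suc b) (+-suc a b) ⟩
  suc (a + b) ! * suc a + suc (a + b) ! * suc b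
    ≡⟨ collect a b (suc (a + b) !) ⟩
  suc (suc (a + b)) !
    ≡⟨ cong (λ w → suc w !) (sym (+-suc a b)) ⟩
  (suc a + suc b) ! ∎
  where
  distribute : ∀ x y a b fa fb → (x + y) * ((suc a * fa) * (suc b * fb))
                 ≡ x * (fa * (suc b * fb)) * suc a + y * ((suc a * fa) * fb) * suc b
  distribute = solve-∀
  collect : ∀ a b f → f * suc a + f * suc b ≡ suc (suc (a + b)) * f
  collect = solve-∀

private
  cancel-a!*b! : ∀ a b {x y} → x * (a ! * b !) ≡ y * (a ! * b !) → x ≡ y
  cancel-a!*b! a b {x} {y} = *-cancelʳ-≡ x y (a ! * b !) {{a !* b !≢0}}

binom-sym : ∀ a b → binom a b ≡ binom b a
binom-sym a b = cancel-a!*b! a b (begin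
  binom a b * (a ! * b !) ≡⟨ binom*a!*b!≡[a+b]! a b ⟩
  (a + b) !               ≡⟨ cong _! (+-comm a b) ⟩
  (b + a) !               ≡⟨ binom*a!*b!≡[a+b]! b a ⟨
  binom b a * (b ! * a !) ≡⟨ cong (binom b a *_) (*-comm (b !) (a !)) ⟩
  binom b a * (a ! * b !) ∎)

[1+b]*binom[a,1+b]*a!*b!≡[1+a+b]! : ∀ a b → suc b * binom a (suc b) * (a ! * b !) ≡ suc (a + b) !
[1+b]*binom[a,1+b]*a!*b!≡[1+a+b]! a b = begin
  suc b * binom a (suc b) * (a ! * b !) ≡⟨ rearrange (binom a (suc b)) (a !) (b !) b ⟩
  binom a (suc b) * (a ! * suc b !)     ≡⟨ binom*a!*b!≡[a+b]! a (suc b) ⟩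
  (a + suc b) !                         ≡⟨ cong _! (+-suc a b) ⟩
  suc (a + b) !                         ∎
  where
  rearrange : ∀ x fa fb b → suc b * x * (fa * fb) ≡ x * (fa * (suc b * fb))
  rearrange = solve-∀

[1+b]*binom[a,1+b]≡[1+a]*binom[1+a,b] : ∀ a b → suc b * binom a (suc b) ≡ suc a * binom (suc a) b
[1+b]*binom[a,1+b]≡[1+a]*binom[1+a,b] a b = cancel-a!*b! a b (begin
  suc b * binom a (suc b) * (a ! * b !) ≡⟨ [1+b]*binom[a,1+b]*a!*b!≡[1+a+b]! a b ⟩
  suc (a + b) !                         ≡⟨ binom*a!*b!≡[a+b]! (suc a) b ⟨
  binom (suc a) b * (suc a ! * b !)     ≡⟨ rearrange (binom (suc a) b) (a !) (b !) a ⟩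
  suc a * binom (suc a) b * (a ! * b !) ∎)
  where
  rearrange : ∀ x fa fb a → x * ((suc a * fa) * fb) ≡ suc a * x * (fa * fb)
  rearrange = solve-∀

[1+b]*binom[a,1+b]≡[1+a+b]*binom[a,b] : ∀ a b → suc b * binom a (suc b) ≡ suc (a + b) * binom a b
[1+b]*binom[a,1+b]≡[1+a+b]*binom[a,b] a b = cancel-a!*b! a b (begin
  suc b * binom a (suc b) * (a ! * b !)   ≡⟨ [1+b]*binom[a,1+b]*a!*b!≡[1+a+b]! a b ⟩
  suc (a + b) * (a + b) !                 ≡⟨ cong (suc (a + b) *_) (binom*a!*b!≡[a+b]! a b) ⟨
  suc (a + b) * (binom a b * (a ! * b !)) ≡⟨ *-assoc (suc (a + b)) (binom a b) _ ⟨
  suc (a + b) * binom a b * (a ! * b !)   ∎)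

[a+b]Cb≡binom : ∀ a b → (a + b) C b ≡ binom a b
[a+b]Cb≡binom zero    b       = nCn≡1 b
[a+b]Cb≡binom (suc a) zero    = refl
[a+b]Cb≡binom (suc a) (suc b) = begin
  suc (a + suc b) C suc b                 ≡⟨ nCk+nC[k+1]≡[n+1]C[k+1] (a + suc b) b ⟨
  (a + suc b) C b + (a + suc b) C suc b   ≡⟨ cong (λ w → w C b + (a + suc b) C suc b) (+-suc a b) ⟩
  (suc a + b) C b + (a + suc b) C suc b   ≡⟨ cong₂ _+_ ([a+b]Cb≡binom (suc a) b) ([a+b]Cb≡binom a (suc b)) ⟩
  binom (suc a) b + binom a (suc b)       ≡⟨ +-comm (binom (suc a) b) (binom a (suc b)) ⟩
  binom a (suc b) + binom (suc a) b       ∎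

central : ℕ → ℕ
central k = binom k k

[2k]Ck≡central : ∀ k → (2 * k) C k ≡ central k
[2k]Ck≡central k = trans (cong (λ w → (k + w) C k) (+-identityʳ k)) ([a+b]Cb≡binom k k)

central[1+k]≡2*binom[1+k,k] : ∀ k → central (suc k) ≡ 2 * binom (suc k) k
central[1+k]≡2*binom[1+k,k] k = begin
  binom k (suc k) + binom (suc k) k       ≡⟨ cong (_+ binom (suc k) k) (binom-sym k (suc k)) ⟩
  binom (suc k) k + binom (suc k) k       ≡⟨ cong (binom (suc k) k +_) (+-identityʳ _) ⟨
  2 * binom (suc k) k                     ∎

[1+k]*central[1+k]≡2[2k+1]*central[k] : ∀ k → suc k * central (suc k) ≡ 2 * (2 * k + 1) * central k
[1+k]*central[1+k]≡2[2k+1]*central[k] k = begin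
  suc k * central (suc k)            ≡⟨ cong (suc k *_) (central[1+k]≡2*binom[1+k,k] k) ⟩
  suc k * (2 * binom (suc k) k)      ≡⟨ cong (λ x → suc k * (2 * x)) (binom-sym (suc k) k) ⟩
  suc k * (2 * binom k (suc k))      ≡⟨ swap k (binom k (suc k)) ⟩
  2 * (suc k * binom k (suc k))      ≡⟨ cong (2 *_) ([1+b]*binom[a,1+b]≡[1+a+b]*binom[a,b] k k) ⟩
  2 * (suc (k + k) * central k)      ≡⟨ regroup k (central k) ⟩
  2 * (2 * k + 1) * central k        ∎
  where
  swap : ∀ k x → suc k * (2 * x) ≡ 2 * (suc k * x)
  swap = solve-∀
  regroup : ∀ k c → 2 * (suc (k + k) * c) ≡ 2 * (2 * k + 1) * c
  regroup = solve-∀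

binom-contiguous : ∀ m j →
  4 * suc j * binom (suc m) j + 2 * (2 * m + 3) * binom (suc m) (suc j)
    ≡ 4 * suc m * binom m (suc j) + 2 * (2 * j + 3) * binom (suc m) (suc j)
binom-contiguous m j = *-cancelˡ-≡ _ _ (suc j) (begin
  suc j * (4 * suc j * X + 2 * (2 * m + 3) * Z)
    ≡⟨ expandˡ m j X Z ⟩
  4 * suc j * suc j * X + 2 * (2 * m + 3) * (suc j * Z)
    ≡⟨ cong (λ z → 4 * suc j * suc j * X + 2 * (2 * m + 3) * z) [1+j]Z ⟩
  4 * suc j * suc j * X + 2 * (2 * m + 3) * (suc (suc (m + j)) * X)
    ≡⟨ balance m j X ⟩
  4 * suc m * (suc m * X) + 2 * (2 * j + 3) * (suc (suc (m + j)) * X)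
    ≡⟨ cong₂ (λ y z → 4 * suc m * y + 2 * (2 * j + 3) * z) [1+j]Y [1+j]Z ⟨
  4 * suc m * (suc j * Y) + 2 * (2 * j + 3) * (suc j * Z)
    ≡⟨ expandʳ m j Y Z ⟨
  suc j * (4 * suc m * Y + 2 * (2 * j + 3) * Z) ∎)
  where
  X = binom (suc m) j
  Y = binom m (suc j)
  Z = binom (suc m) (suc j)
  [1+j]Y : suc j * Y ≡ suc m * X
  [1+j]Y = [1+b]*binom[a,1+b]≡[1+a]*binom[1+a,b] m j
  [1+j]Z : suc j * Z ≡ suc (suc (m + j)) * X
  [1+j]Z = [1+b]*binom[a,1+b]≡[1+a+b]*binom[a,b] (suc m) j
  expandˡ : ∀ m j x z → suc j * (4 * suc j * x + 2 * (2 * m + 3) * z)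
              ≡ 4 * suc j * suc j * x + 2 * (2 * m + 3) * (suc j * z)
  expandˡ = solve-∀
  expandʳ : ∀ m j y z → suc j * (4 * suc m * y + 2 * (2 * j + 3) * z)
              ≡ 4 * suc m * (suc j * y) + 2 * (2 * j + 3) * (suc j * z)
  expandʳ = solve-∀
  balance : ∀ m j x → 4 * suc j * suc j * x + 2 * (2 * m + 3) * (suc (suc (m + j)) * x)
              ≡ 4 * suc m * (suc m * x) + 2 * (2 * j + 3) * (suc (suc (m + j)) * x)
  balance = solve-∀

-- σ m j = ∑_{i ≤ j} 4^(j-i) C(2i, i) C(m+i, i), so A m = σ m m.
σ : ℕ → ℕ → ℕ
σ m zero    = 1
σ m (suc j) = 4 * σ m j + central (suc j) * binom m (suc j)

σ-shift : ∀ m j → 2 * (2 * m + 3) * σ (suc m) j ≡ 4 * suc m * σ m j + suc j * central (suc j) * binom (suc m) j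
σ-shift m zero    = base m
  where
  base : ∀ m → 2 * (2 * m + 3) * 1 ≡ 4 * suc m * 1 + 1 * 2 * 1
  base = solve-∀
σ-shift m (suc j) = begin
  2 * (2 * m + 3) * (4 * σ (suc m) j + B * Z)
    ≡⟨ expand m (σ (suc m) j) B Z ⟩
  4 * (2 * (2 * m + 3) * σ (suc m) j) + B * (2 * (2 * m + 3) * Z)
    ≡⟨ cong (λ u → 4 * u + B * (2 * (2 * m + 3) * Z)) (σ-shift m j) ⟩
  4 * (4 * suc m * σ m j + suc j * B * X) + B * (2 * (2 * m + 3) * Z)
    ≡⟨ factor m j (σ m j) B X Z ⟩
  16 * suc m * σ m j + B * (4 * suc j * X + 2 * (2 * m + 3) * Z)
    ≡⟨ cong (λ u → 16 * suc m * σ m j + B * u) (binom-contiguous m j) ⟩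
  16 * suc m * σ m j + B * (4 * suc m * Y + 2 * (2 * j + 3) * Z)
    ≡⟨ unfactor m j (σ m j) B Y Z ⟩
  4 * suc m * (4 * σ m j + B * Y) + 2 * (2 * suc j + 1) * B * Z
    ≡⟨ cong (λ u → 4 * suc m * (4 * σ m j + B * Y) + u * Z) ([1+k]*central[1+k]≡2[2k+1]*central[k] (suc j)) ⟨
  4 * suc m * (4 * σ m j + B * Y) + suc (suc j) * central (suc (suc j)) * Z ∎
  where
  B = central (suc j)
  X = binom (suc m) j
  Y = binom m (suc j)
  Z = binom (suc m) (suc j)
  expand : ∀ m s b z → 2 * (2 * m + 3) * (4 * s + b * z) ≡ 4 * (2 * (2 * m + 3) * s) + b * (2 * (2 * m + 3) * z)
  expand = solve-∀
  factor : ∀ m j s b x z → 4 * (4 * suc m * s + suc j * b * x) + b * (2 * (2 * m + 3) * z)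
             ≡ 16 * suc m * s + b * (4 * suc j * x + 2 * (2 * m + 3) * z)
  factor = solve-∀
  unfactor : ∀ m j s b y z → 16 * suc m * s + b * (4 * suc m * y + 2 * (2 * j + 3) * z)
               ≡ 4 * suc m * (4 * s + b * y) + 2 * (2 * suc j + 1) * b * z
  unfactor = solve-∀

σ-diagonal-rec : ∀ m → 2 * (2 * m + 3) * σ (suc m) (suc m)
                         ≡ 16 * suc m * σ m m + 2 * (3 * m + 4) * central (suc m) * central (suc m)
σ-diagonal-rec m = begin
  2 * (2 * m + 3) * (4 * σ (suc m) m + c * c)
    ≡⟨ expand m (σ (suc m) m) c ⟩
  4 * (2 * (2 * m + 3) * σ (suc m) m) + 2 * (2 * m + 3) * c * c
    ≡⟨ cong (λ u → 4 * u + 2 * (2 * m + 3) * c * c) (σ-shift m m) ⟩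
  4 * (4 * suc m * σ m m + suc m * c * X) + 2 * (2 * m + 3) * c * c
    ≡⟨ regroup m (σ m m) c X ⟩
  16 * suc m * σ m m + 2 * suc m * c * (2 * X) + 2 * (2 * m + 3) * c * c
    ≡⟨ cong (λ u → 16 * suc m * σ m m + 2 * suc m * c * u + 2 * (2 * m + 3) * c * c) (central[1+k]≡2*binom[1+k,k] m) ⟨
  16 * suc m * σ m m + 2 * suc m * c * c + 2 * (2 * m + 3) * c * c
    ≡⟨ collect m (σ m m) c ⟩
  16 * suc m * σ m m + 2 * (3 * m + 4) * c * c ∎
  where
  c = central (suc m)
  X = binom (suc m) m
  expand : ∀ m s c → 2 * (2 * m + 3) * (4 * s + c * c) ≡ 4 * (2 * (2 * m + 3) * s) + 2 * (2 * m + 3) * c * c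
  expand = solve-∀
  regroup : ∀ m s c x → 4 * (4 * suc m * s + suc m * c * x) + 2 * (2 * m + 3) * c * c
              ≡ 16 * suc m * s + 2 * suc m * c * (2 * x) + 2 * (2 * m + 3) * c * c
  regroup = solve-∀
  collect : ∀ m s c → 16 * suc m * s + 2 * suc m * c * c + 2 * (2 * m + 3) * c * c
              ≡ 16 * suc m * s + 2 * (3 * m + 4) * c * c
  collect = solve-∀

horner : ℕ → (ℕ → ℕ) → ℕ → ℕ
horner b f n = sum (map (λ k → f k * b ^ (n ∸ 1 ∸ k)) (upTo n))

horner-head : ∀ b f n → horner b f (suc n) ≡ f 0 * b ^ n + horner b (f ∘ suc) n
horner-head b f n = cong (λ xs → f 0 * b ^ n + sum xs) (begin
  map term (applyUpTo suc n)   ≡⟨ map-applyUpTo suc term n ⟩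
  applyUpTo (term ∘ suc) n     ≡⟨ map-upTo (term ∘ suc) n ⟨
  map (term ∘ suc) (upTo n)    ≡⟨ map-cong (λ k → cong (λ e → f (suc k) * b ^ e) (∸-+-assoc n 1 k)) (upTo n) ⟨
  map (λ k → f (suc k) * b ^ (n ∸ 1 ∸ k)) (upTo n) ∎)
  where
  term : ℕ → ℕ
  term k = f k * b ^ (suc n ∸ 1 ∸ k)

horner-suc : ∀ b f n → horner b f (suc n) ≡ b * horner b f n + f n
horner-suc b f zero    = base b (f 0)
  where
  base : ∀ b x → x * 1 + 0 ≡ b * 0 + x
  base = solve-∀
horner-suc b f (suc n) = begin
  horner b f (suc (suc n))                                      ≡⟨ horner-head b f (suc n) ⟩
  f 0 * b ^ suc n + horner b (f ∘ suc) (suc n)                  ≡⟨ cong (f 0 * b ^ suc n +_) (horner-suc b (f ∘ suc) n) ⟩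
  f 0 * (b * b ^ n) + (b * horner b (f ∘ suc) n + f (suc n))    ≡⟨ factor b (f 0) (b ^ n) (horner b (f ∘ suc) n) (f (suc n)) ⟩
  b * (f 0 * b ^ n + horner b (f ∘ suc) n) + f (suc n)          ≡⟨ cong (λ u → b * u + f (suc n)) (horner-head b f n) ⟨
  b * horner b f (suc n) + f (suc n)                            ∎
  where
  factor : ∀ b x p h y → x * (b * p) + (b * h + y) ≡ b * (x * p + h) + y
  factor = solve-∀

S-suc : ∀ n → S (suc n) ≡ 16 * S n + (3 * n + 1) * central n ^ 3
S-suc n = trans (horner-suc 16 (λ k → (3 * k + 1) * ((2 * k) C k) ^ 3) n)
                (cong (λ c → 16 * S n + (3 * n + 1) * c ^ 3) ([2k]Ck≡central n))

2*S[1+m]≡[1+m]*central[1+m]*σ[m,m] : ∀ m → 2 * S (suc m) ≡ suc m * central (suc m) * σ m m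
2*S[1+m]≡[1+m]*central[1+m]*σ[m,m] zero    = refl
2*S[1+m]≡[1+m]*central[1+m]*σ[m,m] (suc m) = begin
  2 * S (suc (suc m))
    ≡⟨ cong (2 *_) (S-suc (suc m)) ⟩
  2 * (16 * S (suc m) + (3 * suc m + 1) * c ^ 3)
    ≡⟨ expand m (S (suc m)) c ⟩
  16 * (2 * S (suc m)) + 2 * (3 * m + 4) * c * c * c
    ≡⟨ cong (λ u → 16 * u + 2 * (3 * m + 4) * c * c * c) (2*S[1+m]≡[1+m]*central[1+m]*σ[m,m] m) ⟩
  16 * (suc m * c * σ m m) + 2 * (3 * m + 4) * c * c * c
    ≡⟨ factor m c (σ m m) ⟩
  c * (16 * suc m * σ m m + 2 * (3 * m + 4) * c * c)
    ≡⟨ cong (c *_) (σ-diagonal-rec m) ⟨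
  c * (2 * (2 * m + 3) * σ (suc m) (suc m))
    ≡⟨ reorder m c (σ (suc m) (suc m)) ⟩
  2 * (2 * suc m + 1) * c * σ (suc m) (suc m)
    ≡⟨ cong (_* σ (suc m) (suc m)) ([1+k]*central[1+k]≡2[2k+1]*central[k] (suc m)) ⟨
  suc (suc m) * central (suc (suc m)) * σ (suc m) (suc m) ∎
  where
  c = central (suc m)
  expand : ∀ k s x → 2 * (16 * s + (3 * suc k + 1) * (x * (x * (x * 1)))) ≡ 16 * (2 * s) + 2 * (3 * k + 4) * x * x * x
  expand = solve-∀
  factor : ∀ m c t → 16 * (suc m * c * t) + 2 * (3 * m + 4) * c * c * c
             ≡ c * (16 * suc m * t + 2 * (3 * m + 4) * c * c)
  factor = solve-∀
  reorder : ∀ m c t → c * (2 * (2 * m + 3) * t) ≡ 2 * (2 * suc m + 1) * c * t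
  reorder = solve-∀

4∣σ[1+m,1+m] : ∀ m → 4 ∣ σ (suc m) (suc m)
4∣σ[1+m,1+m] m = ∣m∣n⇒∣m+n (m∣m*n (σ (suc m) m)) (*-pres-∣ 2∣c 2∣c)
  where
  2∣c : 2 ∣ central (suc m)
  2∣c = subst (2 ∣_) (sym (central[1+k]≡2*binom[1+k,k] m)) (m∣m*n (binom (suc m) m))

theorem1p1 : (n : ℕ) → 2 ≤ n → (2 * n) * ((2 * n) C n) ∣ S n
theorem1p1 n@(suc (suc m)) (s≤s (s≤s _)) with 4∣σ[1+m,1+m] m
... | divides q σ≡q*4 = *-cancelˡ-∣ 2 (divides q (begin
  2 * S n                              ≡⟨ 2*S[1+m]≡[1+m]*central[1+m]*σ[m,m] (suc m) ⟩
  n * central n * σ (suc m) (suc m)    ≡⟨ cong (n * central n *_) σ≡q*4 ⟩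
  n * central n * (q * 4)              ≡⟨ regroup n (central n) q ⟩
  q * (2 * (2 * n * central n))        ≡⟨ cong (λ c → q * (2 * (2 * n * c))) ([2k]Ck≡central n) ⟨
  q * (2 * (2 * n * ((2 * n) C n)))    ∎))
  where
  regroup : ∀ n c q → n * c * (q * 4) ≡ q * (2 * (2 * n * c))
  regroup = solve-∀
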